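{- Let $a\in\{0,1\}$, $\ell\ge2$, and let $u\in\{0,1\}^\ell$ have last letter $1$. Then $\Lambda_a(a^\ell)(u)=2^{\lceil\log_2\ell\rceil}$.
   Context: For words $w=w_1\cdots w_\ell$, $u=u_1\cdots u_\ell$ over $\{0,1\}$ and $a\in\{0,1\}$, $S_a(w)(u)\in\{0,1\}^\ell$ is the word with $\ell$-th letter $u_\ell$ and $i$-th letter $u_i\oplus(u_{i+1}\wedge[w_{i+1}=a])$ for $1\le i\le\ell-1$ ($[\cdot]$ the indicator; $\oplus,\wedge$ XOR/AND); it is a bijection of $\{0,1\}^\ell$. $\Lambda_a(w)(u)$ is the least $m\ge1$ with $S_a(w)^m(u)=u$. $a^\ell$ is the word of $\ell$ copies of $a$. -}

module Defs where

open import Data.Bool using (Bool; true; false; _xor_; _∧_; if_then_else_)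
open import Data.Bool.Properties using () renaming (_≟_ to _≟ᵇ_)
open import Data.Nat using (ℕ; zero; suc; _<_; _≤_)
open import Data.Vec using (Vec; []; _∷_; replicate; last)
open import Relation.Binary.PropositionalEquality using (_≡_)
open import Relation.Nullary.Decidable using (⌊_⌋)

-- Bits 0,1 are represented by false,true.
-- [x = a] as a Bool
eqb : Bool → Bool → Bool
eqb x a = ⌊ x ≟ᵇ a ⌋

S : {ℓ : ℕ} → Bool → Vec Bool ℓ → Vec Bool ℓ → Vec Bool ℓ
S a [] [] = []
S a (w₁ ∷ []) (u₁ ∷ []) = u₁ ∷ []
S a (w₁ ∷ w₂ ∷ ws) (u₁ ∷ u₂ ∷ us) =
  (u₁ xor (u₂ ∧ eqb w₂ a)) ∷ S a (w₂ ∷ ws) (u₂ ∷ us)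

-- last letter of a word (Nothing-free: the empty word has no last letter,
-- we return false, irrelevant since ℓ ≥ 2 in the statement)
lastLetter : {ℓ : ℕ} → Vec Bool ℓ → Bool
lastLetter [] = false
lastLetter (x ∷ []) = x
lastLetter (x ∷ y ∷ ys) = lastLetter (y ∷ ys)

iter : {A : Set} → ℕ → (A → A) → A → A
iter zero f x = x
iter (suc m) f x = f (iter m f x)

IsΛ : {ℓ : ℕ} → Bool → Vec Bool ℓ → Vec Bool ℓ → ℕ → Set
IsΛ a w u m =
  (1 ≤ m) × (iter m (S a w) u ≡ u) ×
  ((k : ℕ) → 1 ≤ k → k < m → ¬ (iter k (S a w) u ≡ u))
  where
    open import Data.Product using (_×_)
    open import Relation.Nullary using (¬_)

{-# OPTIONS --safe #-}
module Submission where

-- Over 𝔽₂, S_a(a^ℓ) is 1 + N for the left shift N(u₁⋯u_ℓ) = u₂⋯u_ℓ0, which is linear and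
-- nilpotent. In characteristic 2, (1 + N)^(2^k) = 1 + N^(2^k), so S^(2^k) fixes u exactly when
-- N^(2^k) u = 0. This happens once 2^k ≥ ℓ, and fails when 2^k < ℓ, since N^(2^k) u still
-- carries the letter u_ℓ = 1. Hence the period of u divides 2^K but not 2^(K-1), for
-- K = ⌈log₂ ℓ⌉.

open import Defs
open import Algebra.Core using (Op₂)
open import Data.Bool using (Bool; true; false; _xor_; _∧_)
open import Data.Bool.Properties using (∧-identityʳ; xor-assoc; xor-same; xor-identityˡ; xor-identityʳ)
open import Data.Nat using (ℕ; zero; suc; _+_; _*_; _^_; _≤_; _<_; z≤n; s≤s; NonZero; ⌊_/2⌋; ⌈_/2⌉)
open import Data.Nat.Properties
open import Data.Nat.Induction using (<-wellFounded)
open import Data.Nat.Divisibility using (_∣_; divides; _∣?_; ∣⇒≤; ∣1⇒≡1; *-cancelˡ-∣; *-monoˡ-∣)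
open import Data.Nat.Coprimality using (Coprime; coprime-divisor)
open import Data.Nat.GCD using (gcd; gcd[m,n]∣m; gcd[m,n]∣n; gcd-GCD; module Bézout)
open import Data.Nat.Logarithm using (⌈log₂_⌉)
open import Data.Nat.Logarithm.Core using (⌈log2⌉)
open import Data.Nat.Primality using (Prime; prime[2]; prime⇒nonZero; prime⇒irreducible)
open import Data.Product using (_,_)
open import Data.Sum using (inj₁; inj₂)
open import Data.Vec using (Vec; []; _∷_; _∷ʳ_; replicate; zipWith)
open import Data.Vec.Properties
  using (zipWith-assoc; zipWith-identityˡ; zipWith-identityʳ; zipWith-inverseˡ; map-id; ∷ʳ-injectiveˡ)
open import Induction.WellFounded using (acc)
open import Relation.Nullary using (¬_; yes; no; contradiction)
open import Relation.Binary.PropositionalEquality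

private
  variable
    A : Set
    m n : ℕ

iter-+ : ∀ m n (f : A → A) x → iter (m + n) f x ≡ iter m f (iter n f x)
iter-+ zero    n f x = refl
iter-+ (suc m) n f x = cong f (iter-+ m n f x)

iter-fix : ∀ k {f : A → A} {x} → f x ≡ x → iter k f x ≡ x
iter-fix zero            fx≡x = refl
iter-fix (suc k) {f} fx≡x = trans (cong f (iter-fix k fx≡x)) fx≡x

iter-homo : ∀ {_∙_ : Op₂ A} {f : A → A} → (∀ x y → f (x ∙ y) ≡ f x ∙ f y) →
            ∀ k x y → iter k f (x ∙ y) ≡ iter k f x ∙ iter k f y
iter-homo homo zero    x y = refl
iter-homo {f = f} homo (suc k) x y = trans (cong f (iter-homo homo k x y)) (homo _ _)

module _ (f : A → A) (x : A) where

  Period : ℕ → Set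
  Period k = iter k f x ≡ x

  period-* : ∀ q → Period m → Period (q * m)
  period-* zero    _ = refl
  period-* {m} (suc q) pm = begin
    iter (m + q * m) f x        ≡⟨ iter-+ m (q * m) f x ⟩
    iter m f (iter (q * m) f x) ≡⟨ cong (iter m f) (period-* q pm) ⟩
    iter m f x                  ≡⟨ pm ⟩
    x                           ∎
    where open ≡-Reasoning

  period-∣ : m ∣ n → Period m → Period n
  period-∣ (divides q refl) = period-* q

  period-+⁻¹ : ∀ m n → Period (m + n) → Period n → Period m
  period-+⁻¹ m n pm+n pn = begin
    iter m f x              ≡⟨ cong (iter m f) pn ⟨
    iter m f (iter n f x)   ≡⟨ iter-+ m n f x ⟨
    iter (m + n) f x        ≡⟨ pm+n ⟩
    x                       ∎
    where open ≡-Reasoning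

  period-gcd : ∀ m n → Period m → Period n → Period (gcd m n)
  period-gcd m n pm pn with Bézout.identity (gcd-GCD m n)
  ... | Bézout.+- a b eq =
    period-+⁻¹ (gcd m n) (b * n) (subst Period (sym eq) (period-* a pm)) (period-* b pn)
  ... | Bézout.-+ a b eq =
    period-+⁻¹ (gcd m n) (a * m) (subst Period (sym eq) (period-* b pn)) (period-* a pm)

¬p∣m⇒coprime : ∀ {p} → Prime p → ¬ p ∣ m → Coprime m p
¬p∣m⇒coprime pp p∤m (i∣m , i∣p) with prime⇒irreducible pp i∣p
... | inj₁ i≡1 = i≡1
... | inj₂ refl = contradiction i∣m p∤m

m∣p^[1+n]⇒m<p^[1+n]⇒m∣p^n : ∀ {p} → Prime p → ∀ n →
                             m ∣ p ^ suc n → m < p ^ suc n → m ∣ p ^ n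
m∣p^[1+n]⇒m<p^[1+n]⇒m∣p^n {m} {p} pp n m∣ m< with p ∣? m
... | no p∤m = coprime-divisor (¬p∣m⇒coprime pp p∤m) m∣
... | yes (divides q refl) = q*p∣p^n n q∣p^n q<p^n
  where
  instance _ = prime⇒nonZero pp
  q∣p^n : q ∣ p ^ n
  q∣p^n = *-cancelˡ-∣ p (subst (_∣ p ^ suc n) (*-comm q p) m∣)
  q<p^n : q < p ^ n
  q<p^n = *-cancelˡ-< p q (p ^ n) (subst (_< p ^ suc n) (*-comm q p) m<)
  q*p∣p^n : ∀ n → q ∣ p ^ n → q < p ^ n → q * p ∣ p ^ n
  q*p∣p^n zero    q∣1 q<1 = contradiction (∣1⇒≡1 q∣1) (<⇒≢ q<1)
  q*p∣p^n (suc n) q∣ q< = subst (q * p ∣_) (*-comm (p ^ n) p)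
    (*-monoˡ-∣ p (m∣p^[1+n]⇒m<p^[1+n]⇒m∣p^n pp n q∣ q<))

period-2^[1+k]-least : ∀ (f : A → A) x k → Period f x (2 ^ suc k) → ¬ Period f x (2 ^ k) →
                       ∀ j → 1 ≤ j → j < 2 ^ suc k → ¬ Period f x j
period-2^[1+k]-least f x k p2^[1+k] ¬p2^k j@(suc _) _ j< pj =
  ¬p2^k (period-∣ f x g∣2^k (period-gcd f x j (2 ^ suc k) pj p2^[1+k]))
  where
  g∣2^k : gcd j (2 ^ suc k) ∣ 2 ^ k
  g∣2^k = m∣p^[1+n]⇒m<p^[1+n]⇒m∣p^n prime[2] k (gcd[m,n]∣n j (2 ^ suc k))
            (≤-<-trans (∣⇒≤ (gcd[m,n]∣m j (2 ^ suc k))) j<)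

infixl 6 _⊕_

_⊕_ : Vec Bool n → Vec Bool n → Vec Bool n
_⊕_ = zipWith _xor_

zeros : Vec Bool n
zeros = replicate _ false

shift : Vec Bool n → Vec Bool n
shift []       = []
shift (x ∷ xs) = xs ∷ʳ false

⊕-assoc : ∀ (u v w : Vec Bool n) → u ⊕ v ⊕ w ≡ u ⊕ (v ⊕ w)
⊕-assoc = zipWith-assoc xor-assoc

⊕-self : ∀ (u : Vec Bool n) → u ⊕ u ≡ zeros
⊕-self u = trans (cong (_⊕ u) (sym (map-id u))) (zipWith-inverseˡ xor-same u)

⊕-identityˡ : ∀ (u : Vec Bool n) → zeros ⊕ u ≡ u
⊕-identityˡ = zipWith-identityˡ xor-identityˡ

⊕-identityʳ : ∀ (u : Vec Bool n) → u ⊕ zeros ≡ u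
⊕-identityʳ = zipWith-identityʳ xor-identityʳ

⊕-cancel : ∀ (u v : Vec Bool n) → u ⊕ v ≡ u → v ≡ zeros
⊕-cancel u v u⊕v≡u = begin
  v              ≡⟨ ⊕-identityˡ v ⟨
  zeros ⊕ v      ≡⟨ cong (_⊕ v) (⊕-self u) ⟨
  u ⊕ u ⊕ v      ≡⟨ ⊕-assoc u u v ⟩
  u ⊕ (u ⊕ v)    ≡⟨ cong (u ⊕_) u⊕v≡u ⟩
  u ⊕ u          ≡⟨ ⊕-self u ⟩
  zeros          ∎
  where open ≡-Reasoning

zipWith-∷ʳ : ∀ {B C : Set} (f : A → B → C) x y (xs : Vec A n) ys →
             zipWith f (xs ∷ʳ x) (ys ∷ʳ y) ≡ zipWith f xs ys ∷ʳ f x y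
zipWith-∷ʳ f x y []       []       = refl
zipWith-∷ʳ f x y (x′ ∷ xs) (y′ ∷ ys) = cong (f x′ y′ ∷_) (zipWith-∷ʳ f x y xs ys)

replicate-∷ʳ : ∀ n (x : A) → replicate n x ∷ʳ x ≡ replicate (suc n) x
replicate-∷ʳ zero    x = refl
replicate-∷ʳ (suc n) x = cong (x ∷_) (replicate-∷ʳ n x)

shift-⊕ : ∀ (u v : Vec Bool n) → shift (u ⊕ v) ≡ shift u ⊕ shift v
shift-⊕ []       []       = refl
shift-⊕ (x ∷ xs) (y ∷ ys) = sym (zipWith-∷ʳ _xor_ false false xs ys)

S-replicate : ∀ a (u : Vec Bool n) → S a (replicate n a) u ≡ u ⊕ shift u
S-replicate a []           = refl
S-replicate a (x ∷ [])     = cong (_∷ []) (sym (xor-identityʳ x))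
S-replicate a (x ∷ y ∷ u) = cong₂ _∷_ (cong (x xor_) y∧[a=a]≡y) (S-replicate a (y ∷ u))
  where
  eqb-refl : ∀ a → eqb a a ≡ true
  eqb-refl false = refl
  eqb-refl true  = refl
  y∧[a=a]≡y : y ∧ eqb a a ≡ y
  y∧[a=a]≡y = trans (cong (y ∧_) (eqb-refl a)) (∧-identityʳ y)

iter-2* : ∀ m (f : A → A) x → iter (2 * m) f x ≡ iter m f (iter m f x)
iter-2* m f x = trans (cong (λ k → iter (m + k) f x) (+-identityʳ m)) (iter-+ m m f x)

[1+M]²≡1+M² : ∀ (F M : Vec Bool n → Vec Bool n) → (∀ u v → M (u ⊕ v) ≡ M u ⊕ M v) →
              (∀ v → F v ≡ v ⊕ M v) → ∀ v → F (F v) ≡ v ⊕ M (M v)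
[1+M]²≡1+M² F M M-⊕ F≗1+M v = begin
  F (F v)                          ≡⟨ F≗1+M (F v) ⟩
  F v ⊕ M (F v)                    ≡⟨ cong (λ w → w ⊕ M w) (F≗1+M v) ⟩
  v ⊕ M v ⊕ M (v ⊕ M v)            ≡⟨ cong (v ⊕ M v ⊕_) (M-⊕ v (M v)) ⟩
  v ⊕ M v ⊕ (M v ⊕ M (M v))        ≡⟨ ⊕-assoc v (M v) _ ⟩
  v ⊕ (M v ⊕ (M v ⊕ M (M v)))      ≡⟨ cong (v ⊕_) (⊕-assoc (M v) (M v) _) ⟨
  v ⊕ (M v ⊕ M v ⊕ M (M v))        ≡⟨ cong (λ w → v ⊕ (w ⊕ M (M v))) (⊕-self (M v)) ⟩
  v ⊕ (zeros ⊕ M (M v))            ≡⟨ cong (v ⊕_) (⊕-identityˡ _) ⟩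
  v ⊕ M (M v)                      ∎
  where open ≡-Reasoning

S-replicate-2^ : ∀ a k (u : Vec Bool n) →
                 iter (2 ^ k) (S a (replicate n a)) u ≡ u ⊕ iter (2 ^ k) shift u
S-replicate-2^ a zero    u = S-replicate a u
S-replicate-2^ {n} a (suc k) u = begin
  iter (2 * 2 ^ k) f u             ≡⟨ iter-2* (2 ^ k) f u ⟩
  iter (2 ^ k) f (iter (2 ^ k) f u)
    ≡⟨ [1+M]²≡1+M² (iter (2 ^ k) f) (iter (2 ^ k) shift) (iter-homo shift-⊕ (2 ^ k))
                   (S-replicate-2^ a k) u ⟩
  u ⊕ iter (2 ^ k) shift (iter (2 ^ k) shift u)
                                   ≡⟨ cong (u ⊕_) (iter-2* (2 ^ k) shift u) ⟨
  u ⊕ iter (2 * 2 ^ k) shift u     ∎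
  where
  open ≡-Reasoning
  f = S a (replicate n a)

shift-∷ʳ-false : ∀ (v : Vec Bool n) → shift (v ∷ʳ false) ≡ shift v ∷ʳ false
shift-∷ʳ-false []      = refl
shift-∷ʳ-false (_ ∷ _) = refl

iter-shift-∷ : ∀ k x (xs : Vec Bool n) → iter (suc k) shift (x ∷ xs) ≡ iter k shift xs ∷ʳ false
iter-shift-∷ zero    x xs = refl
iter-shift-∷ (suc k) x xs =
  trans (cong shift (iter-shift-∷ k x xs)) (shift-∷ʳ-false (iter k shift xs))

shift-nilpotent : ∀ k (u : Vec Bool n) → n ≤ k → iter k shift u ≡ zeros
shift-nilpotent k       []       _         = iter-fix k refl
shift-nilpotent (suc k) (x ∷ xs) (s≤s n≤k) = begin
  iter (suc k) shift (x ∷ xs)      ≡⟨ iter-shift-∷ k x xs ⟩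
  iter k shift xs ∷ʳ false         ≡⟨ cong (_∷ʳ false) (shift-nilpotent k xs n≤k) ⟩
  zeros ∷ʳ false                   ≡⟨ replicate-∷ʳ _ false ⟩
  zeros                            ∎
  where open ≡-Reasoning

lastLetter-zeros : ∀ n → lastLetter (zeros {n}) ≡ false
lastLetter-zeros zero          = refl
lastLetter-zeros (suc zero)    = refl
lastLetter-zeros (suc (suc n)) = lastLetter-zeros (suc n)

shift-iter-≢-zeros : ∀ k (u : Vec Bool n) → k < n → lastLetter u ≡ true → iter k shift u ≢ zeros
shift-iter-≢-zeros {n} zero u _ last u≡0 =
  contradiction (trans (sym last) (trans (cong lastLetter u≡0) (lastLetter-zeros n))) λ ()
shift-iter-≢-zeros (suc k) (x ∷ y ∷ ys) (s≤s k<) last eq =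
  shift-iter-≢-zeros k (y ∷ ys) k< last
    (∷ʳ-injectiveˡ _ _ (begin
      iter k shift (y ∷ ys) ∷ʳ false ≡⟨ iter-shift-∷ k x (y ∷ ys) ⟨
      iter (suc k) shift (x ∷ y ∷ ys) ≡⟨ eq ⟩
      zeros                          ≡⟨ replicate-∷ʳ _ false ⟨
      zeros ∷ʳ false                 ∎))
  where open ≡-Reasoning

S-replicate-period : ∀ a k (u : Vec Bool n) → n ≤ 2 ^ k → Period (S a (replicate n a)) u (2 ^ k)
S-replicate-period a k u n≤2^k = begin
  iter (2 ^ k) (S a (replicate _ a)) u ≡⟨ S-replicate-2^ a k u ⟩
  u ⊕ iter (2 ^ k) shift u           ≡⟨ cong (u ⊕_) (shift-nilpotent (2 ^ k) u n≤2^k) ⟩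
  u ⊕ zeros                          ≡⟨ ⊕-identityʳ u ⟩
  u                                  ∎
  where open ≡-Reasoning

S-replicate-¬period : ∀ a k (u : Vec Bool n) → 2 ^ k < n → lastLetter u ≡ true →
                      ¬ Period (S a (replicate n a)) u (2 ^ k)
S-replicate-¬period a k u 2^k<n last period =
  shift-iter-≢-zeros (2 ^ k) u 2^k<n last
    (⊕-cancel u _ (trans (sym (S-replicate-2^ a k u)) period))

Λ-replicate : ∀ a k (u : Vec Bool n) → lastLetter u ≡ true →
              n ≤ 2 ^ k → 2 ^ k < 2 * n → IsΛ a (replicate n a) u (2 ^ k)
Λ-replicate a zero u _ n≤1 _ =
  ≤-refl , S-replicate-period a zero u n≤1 , λ j 1≤j j<1 → contradiction 1≤j (<⇒≱ j<1)
Λ-replicate a (suc k) u last n≤2^[1+k] 2^[1+k]<2n =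
  m^n>0 2 (suc k) , period ,
  period-2^[1+k]-least _ u k period (S-replicate-¬period a k u (*-cancelˡ-< 2 _ _ 2^[1+k]<2n) last)
  where period = S-replicate-period a (suc k) u n≤2^[1+k]

n≤2^⌈log2⌉n : ∀ n acc → n ≤ 2 ^ ⌈log2⌉ n acc
n≤2^⌈log2⌉n zero          _        = z≤n
n≤2^⌈log2⌉n (suc zero)    _        = ≤-refl
n≤2^⌈log2⌉n (suc (suc n)) (acc rs) = begin
  2 + n                     ≤⟨ +-monoʳ-≤ 2 n≤c+c ⟩
  2 + (c + c)               ≡⟨ cong (λ m → 2 + (c + m)) (+-identityʳ c) ⟨
  2 + 2 * c                 ≡⟨ *-suc 2 c ⟨
  2 * suc c                 ≤⟨ *-monoʳ-≤ 2 (n≤2^⌈log2⌉n (suc c) (rs (⌈n/2⌉<n n))) ⟩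
  2 * 2 ^ ⌈log2⌉ (suc c) _  ∎
  where
  open ≤-Reasoning
  c = ⌈ n /2⌉
  n≤c+c : n ≤ c + c
  n≤c+c = subst (_≤ c + c) (⌊n/2⌋+⌈n/2⌉≡n n) (+-monoˡ-≤ c (⌊n/2⌋≤⌈n/2⌉ n))

2^⌈log2⌉[2+n]≤2*[1+n] : ∀ n acc → 2 ^ ⌈log2⌉ (2 + n) acc ≤ 2 * (1 + n)
2^⌈log2⌉[2+n]≤2*[1+n] zero    (acc _)  = ≤-refl
2^⌈log2⌉[2+n]≤2*[1+n] (suc n) (acc rs) =
  *-monoʳ-≤ 2 (≤-trans (2^⌈log2⌉[2+n]≤2*[1+n] h (rs (⌈n/2⌉<n (suc n)))) 2*[1+h]≤2+n)
  where
  open ≤-Reasoning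
  h = ⌊ n /2⌋
  2*[1+h]≤2+n : 2 * (1 + h) ≤ 2 + n
  2*[1+h]≤2+n = begin
    2 * (1 + h)         ≡⟨ *-suc 2 h ⟩
    2 + (h + (h + 0))   ≡⟨ cong (λ m → 2 + (h + m)) (+-identityʳ h) ⟩
    2 + (h + h)         ≤⟨ +-monoʳ-≤ 2 (+-monoʳ-≤ h (⌊n/2⌋≤⌈n/2⌉ n)) ⟩
    2 + (h + ⌈ n /2⌉)   ≡⟨ cong (2 +_) (⌊n/2⌋+⌈n/2⌉≡n n) ⟩
    2 + n               ∎

2^⌈log₂n⌉<2*n : ∀ n .{{_ : NonZero n}} → 2 ^ ⌈log₂ n ⌉ < 2 * n
2^⌈log₂n⌉<2*n (suc zero)    = n<1+n 1
2^⌈log₂n⌉<2*n (suc (suc n)) =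
  ≤-<-trans (2^⌈log2⌉[2+n]≤2*[1+n] n (<-wellFounded (2 + n))) (*-monoʳ-< 2 (n<1+n (suc n)))

-- 2 ≤ ℓ only rules out ℓ = 0 here; the argument also covers ℓ = 1.
corollary6p5 : (a : Bool) (ℓ : ℕ) → 2 ≤ ℓ → (u : Vec Bool ℓ) →
    lastLetter u ≡ true → IsΛ a (replicate ℓ a) u (2 ^ ⌈log₂ ℓ ⌉)
corollary6p5 a ℓ@(suc _) _ u last =
  Λ-replicate a ⌈log₂ ℓ ⌉ u last (n≤2^⌈log2⌉n ℓ (<-wellFounded ℓ)) (2^⌈log₂n⌉<2*n ℓ)
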